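{- Let $G$ be a finite connected graph on $n$ vertices and $k\geq1$ an integer, and let $\mathcal{E}_k$ be the scramble on $G$ whose eggs are exactly the connected subsets of $V(G)$ with exactly $k$ vertices. Then the order of $\mathcal{E}_k$ is $\|\mathcal{E}_k\|=\min(\lambda_k(G),\,n-\alpha_{k-1}^c(G))$.
   Context: Graphs are finite, connected, undirected multigraphs without loops. For $A,B\subseteq V(G)$, $E(A,B)$ is the multiset of edges with one endpoint in $A$ and the other in $B$. A set $S\subseteq V(G)$ is connected if $G[S]$ is connected. $\lambda_k(G)$ is the minimum size of a multiset $T\subseteq E(G)$ such that $G-T$ is disconnected and every component of $G-T$ has at least $k$ vertices ($\infty$ if no such $T$). $\alpha_j^c(G)$ is the maximum size of $S\subseteq V(G)$ such that every component of $G[S]$ has at most $j$ vertices. A scramble is a collection $\mathcal{S}$ of nonempty connected subsets (eggs); $h(\mathcal{S})$ is the minimum size of a set meeting every egg; an egg-cut is $A\subseteq V(G)$ with both $A$ and $A^C$ containing an egg, of size $|E(A,A^C)|$; $e(\mathcal{S})$ is the minimum size of an egg-cut ($\infty$ if none); the order is $\|\mathcal{S}\|=\min(h(\mathcal{S}),e(\mathcal{S}))$. -}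

module Defs where

open import Data.Nat using (ℕ; zero; suc; _+_; _∸_; _≤_; _<_; _⊓_)
open import Data.Fin using (Fin; toℕ)
open import Data.Fin.Subset using (Subset; _∈_; _∉_; _⊆_; ∁; ∣_∣; Nonempty)
open import Data.Fin.Subset.Properties using (_∈?_)
open import Data.Product using (Σ; ∃; _×_; _,_)
open import Relation.Binary.PropositionalEquality using (_≡_)
open import Relation.Nullary using (¬_; yes; no)
import Data.Nat.Properties as ℕP

∑ : ∀ {n} → (Fin n → ℕ) → ℕ
∑ {zero}  f = 0
∑ {suc n} f = f Fin.zero + ∑ (λ i → f (Fin.suc i))
  where import Data.Fin as Fin

-- A multigraph on vertex set Fin n is given by edge multiplicities
-- mult i j = number of edges between i and j (symmetric, no loops).
Mult : ℕ → Set
Mult n = Fin n → Fin n → ℕ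

data Walk {n} (m : Mult n) (S : Subset n) : Fin n → Fin n → Set where
  here : ∀ {u} → u ∈ S → Walk m S u u
  step : ∀ {u v w} → u ∈ S → 0 < m u v → Walk m S v w → Walk m S u w

Connected : ∀ {n} → Mult n → Subset n → Set
Connected m S = Nonempty S × (∀ u v → u ∈ S → v ∈ S → Walk m S u v)

IsComponent : ∀ {n} → Mult n → Subset n → Subset n → Set
IsComponent m S C =
  C ⊆ S × Connected m C × (∀ C' → C ⊆ C' → C' ⊆ S → Connected m C' → C' ⊆ C)

record Graph (n : ℕ) : Set where
  field
    mult      : Mult n
    symmetric : ∀ i j → mult i j ≡ mult j i
    loopless  : ∀ i → mult i i ≡ 0
    nonempty  : 1 ≤ n
    connected : Connected mult (Data.Fin.Subset.⊤)
open Graph public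

data ℕ∞ : Set where
  fin : ℕ → ℕ∞
  ∞   : ℕ∞

min∞ : ℕ∞ → ℕ∞ → ℕ∞
min∞ (fin a) (fin b) = fin (a ⊓ b)
min∞ (fin a) ∞       = fin a
min∞ ∞       y       = y

IsMin : (ℕ → Set) → ℕ∞ → Set
IsMin P (fin v) = P v × (∀ y → P y → v ≤ y)
IsMin P ∞       = ∀ y → ¬ P y

IsMax : (ℕ → Set) → ℕ → Set
IsMax P v = P v × (∀ y → P y → y ≤ v)

cutSize : ∀ {n} → Mult n → Subset n → ℕ
cutSize m A = ∑ λ i → ∑ λ j → ind i j
  where
  ind : _ → _ → ℕ
  ind i j with i ∈? A | j ∈? A
  ... | yes _ | no _ = m i j
  ... | _     | _    = 0

edgeCount : ∀ {n} → Mult n → ℕ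
edgeCount t = ∑ λ i → ∑ λ j → ind i j
  where
  ind : _ → _ → ℕ
  ind i j with toℕ i Data.Nat.<? toℕ j
  ... | yes _ = t i j
  ... | no _  = 0

-- T is a sub-multiset of E(G) (symmetric multiplicity function bounded by G's)
IsEdgeSubMultiset : ∀ {n} → Graph n → Mult n → Set
IsEdgeSubMultiset G t = (∀ i j → t i j ≡ t j i) × (∀ i j → t i j ≤ mult G i j)

remove : ∀ {n} → Graph n → Mult n → Mult n
remove G t i j = mult G i j ∸ t i j

IsLambda : ∀ {n} → Graph n → ℕ → ℕ∞ → Set
IsLambda {n} G k = IsMin λ s → Σ (Mult n) λ t →
    IsEdgeSubMultiset G t × edgeCount t ≡ s
  × ¬ Connected (remove G t) Data.Fin.Subset.⊤
  × (∀ C → IsComponent (remove G t) Data.Fin.Subset.⊤ C → k ≤ ∣ C ∣)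

IsAlphaC : ∀ {n} → Graph n → ℕ → ℕ → Set
IsAlphaC {n} G j = IsMax λ s → Σ (Subset n) λ S →
  ∣ S ∣ ≡ s × (∀ C → IsComponent (mult G) S C → ∣ C ∣ ≤ j)

record Scramble {n} (G : Graph n) : Set₁ where
  field
    Egg           : Subset n → Set
    egg-connected : ∀ E → Egg E → Connected (mult G) E
open Scramble public

IsHitting : ∀ {n} {G : Graph n} → Scramble G → ℕ∞ → Set
IsHitting {n} 𝓢 = IsMin λ s → Σ (Subset n) λ X →
  ∣ X ∣ ≡ s × (∀ E → Egg 𝓢 E → ∃ λ v → v ∈ E × v ∈ X)

IsEggCut : ∀ {n} {G : Graph n} → Scramble G → Subset n → Set
IsEggCut {n} 𝓢 A =
  (Σ (Subset n) λ E → Egg 𝓢 E × E ⊆ A) × (Σ (Subset n) λ E → Egg 𝓢 E × E ⊆ ∁ A)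

IsEggCutNumber : ∀ {n} {G : Graph n} → Scramble G → ℕ∞ → Set
IsEggCutNumber {n} {G} 𝓢 = IsMin λ s → Σ (Subset n) λ A →
  IsEggCut 𝓢 A × cutSize (mult G) A ≡ s

IsOrder : ∀ {n} {G : Graph n} → Scramble G → ℕ∞ → Set
IsOrder 𝓢 o = ∀ h e → IsHitting 𝓢 h → IsEggCutNumber 𝓢 e → o ≡ min∞ h e

𝓔 : ∀ {n} (G : Graph n) → ℕ → Scramble G
𝓔 G k = record
  { Egg = λ S → Connected (mult G) S × ∣ S ∣ ≡ k
  ; egg-connected = λ E p → Data.Product.proj₁ p }

{-# OPTIONS --safe #-}
module Submission where

-- A set X meets every connected k-set exactly when every component of G − X has fewer than k
-- vertices, so h(𝓔ₖ) = n − α_{k-1}. For e(𝓔ₖ) = λₖ: if G − T has only components of at least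
-- k vertices, one such component A is an egg-cut with |E(A, Aᶜ)| ≤ |T|. Conversely, if A is a
-- minimum egg-cut then every component of G − E(A, Aᶜ) lies on one side and has at least k
-- vertices, as moving a smaller one across would shrink the cut while keeping an egg on each side.

open import Defs
open import Data.Nat using (ℕ; zero; suc; _+_; _∸_; _≤_; _<_; z≤n; s≤s; _<?_; _≤?_)
import Data.Nat.Properties as ℕ
open import Algebra.Properties.CommutativeMonoid.Sum ℕ.+-0-commutativeMonoid as Sum
  using (sum; sum-cong-≗)
open import Data.Fin using (Fin; toℕ; zero; suc)
open import Data.Fin.Properties using (toℕ-injective; any?)
open import Data.Fin.Subset using (Subset; _∈_; _∉_; _⊆_; ∁; ⊤; _∪_; _∩_; ⁅_⁆; ∣_∣; inside; outside)
open import Data.Fin.Subset.Properties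
  using (_∈?_; ∈⊤; x∈∁p⇒x∉p; x∉p⇒x∈∁p; x∈p⇒x∉∁p; x∈⁅x⁆; x∈⁅y⁆⇒x≡y; x∈p∪q⁻; x∈p∪q⁺; p⊆p∪q; ∪-identityʳ;
         ∣p∣≤n; ∣⁅x⁆∣≡1; p⊆q⇒∣p∣≤∣q∣; x∉∁p⇒x∈p; ∣∁p∣≡n∸∣p∣;
         x∈p∩q⁺; x∈p∩q⁻)
open import Data.Vec using (_∷_; here; there)
open import Data.Product using (Σ; ∃; _×_; _,_; proj₁; proj₂)
open import Data.Sum using (_⊎_; inj₁; inj₂)
open import Function using (_∘_; flip; id)
open import Relation.Binary.PropositionalEquality
  using (_≡_; refl; sym; trans; cong; cong₂; subst; subst₂; module ≡-Reasoning)
open import Relation.Nullary using (¬_; Dec; yes; no; contradiction)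
open import Relation.Nullary.Decidable using (map′; _×-dec_; ¬?; decidable-stable)

∑≗sum : ∀ {n} (f : Fin n → ℕ) → ∑ f ≡ sum f
∑≗sum {zero}  f = refl
∑≗sum {suc n} f = cong (f zero +_) (∑≗sum (f ∘ suc))

∑-distrib-+ : ∀ {n} (f g : Fin n → ℕ) → ∑ (λ i → f i + g i) ≡ ∑ f + ∑ g
∑-distrib-+ f g = trans (∑≗sum (λ i → f i + g i))
  (trans (Sum.∑-distrib-+ f g) (sym (cong₂ _+_ (∑≗sum f) (∑≗sum g))))

∑-cong : ∀ {n} {f g : Fin n → ℕ} → (∀ i → f i ≡ g i) → ∑ f ≡ ∑ g
∑-cong {zero}  f≡g = refl
∑-cong {suc n} f≡g = cong₂ _+_ (f≡g zero) (∑-cong (f≡g ∘ suc))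

∑-mono-≤ : ∀ {n} {f g : Fin n → ℕ} → (∀ i → f i ≤ g i) → ∑ f ≤ ∑ g
∑-mono-≤ {zero}  f≤g = z≤n
∑-mono-≤ {suc n} f≤g = ℕ.+-mono-≤ (f≤g zero) (∑-mono-≤ (f≤g ∘ suc))

∑-mono-< : ∀ {n} {f g : Fin n → ℕ} → (∀ i → f i ≤ g i) → ∀ i → f i < g i → ∑ f < ∑ g
∑-mono-< f≤g zero    fi<gi = ℕ.+-mono-<-≤ fi<gi (∑-mono-≤ (f≤g ∘ suc))
∑-mono-< f≤g (suc i) fi<gi = ℕ.+-mono-≤-< (f≤g zero) (∑-mono-< (f≤g ∘ suc) i fi<gi)

∑∑ : ∀ {n} → (Fin n → Fin n → ℕ) → ℕ
∑∑ F = ∑ λ i → ∑ (F i)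

∑∑-cong : ∀ {n} {F H : Fin n → Fin n → ℕ} → (∀ i j → F i j ≡ H i j) → ∑∑ F ≡ ∑∑ H
∑∑-cong F≡H = ∑-cong (∑-cong ∘ F≡H)

∑∑-distrib-+ : ∀ {n} (F H : Fin n → Fin n → ℕ) → ∑∑ (λ i j → F i j + H i j) ≡ ∑∑ F + ∑∑ H
∑∑-distrib-+ F H = trans (∑-cong λ i → ∑-distrib-+ (F i) (H i))
  (∑-distrib-+ (λ i → ∑ (F i)) (λ i → ∑ (H i)))

∑∑-transpose : ∀ {n} (F : Fin n → Fin n → ℕ) → ∑∑ (flip F) ≡ ∑∑ F
∑∑-transpose F = trans (∑∑≗ (flip F)) (trans (sym (Sum.∑-comm F)) (sym (∑∑≗ F)))
  where
  ∑∑≗ : ∀ G → ∑∑ G ≡ sum (λ i → sum (G i))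
  ∑∑≗ G = trans (∑≗sum (λ i → ∑ (G i))) (sum-cong-≗ (∑≗sum ∘ G))

∑∑-mono-≤ : ∀ {n} {F H : Fin n → Fin n → ℕ} → (∀ i j → F i j ≤ H i j) → ∑∑ F ≤ ∑∑ H
∑∑-mono-≤ F≤H = ∑-mono-≤ (∑-mono-≤ ∘ F≤H)

∑∑-mono-< : ∀ {n} {F H : Fin n → Fin n → ℕ} → (∀ i j → F i j ≤ H i j) →
  ∀ i j → F i j < H i j → ∑∑ F < ∑∑ H
∑∑-mono-< F≤H i j Fij<Hij = ∑-mono-< (∑-mono-≤ ∘ F≤H) i (∑-mono-< (F≤H i) j Fij<Hij)

-- Defs writes the summands of cutSize and edgeCount in where-blocks; summandOf names them by
-- unifying a definitional equation with ∑∑ F. So crossing m A i j is m i j when i ∈ A and j ∉ A,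
-- and 0 otherwise; upper t i j is t i j when toℕ i < toℕ j, and 0 otherwise.
summandOf : ∀ {n} {s : ℕ} {F : Fin n → Fin n → ℕ} → s ≡ ∑∑ F → Fin n → Fin n → ℕ
summandOf {F = F} _ = F

crossing : ∀ {n} → Mult n → Subset n → Mult n
crossing m A = summandOf (refl {x = cutSize m A})

upper : ∀ {n} → Mult n → Mult n
upper t = summandOf (refl {x = edgeCount t})

Symmetric : ∀ {n} → Mult n → Set
Symmetric m = ∀ i j → m i j ≡ m j i

module _ {n : ℕ} {m : Mult n} where

  crossing≡mult : ∀ {A i j} → i ∈ A → j ∉ A → crossing m A i j ≡ m i j
  crossing≡mult {A} {i} {j} i∈A j∉A with i ∈? A | j ∈? A
  ... | yes _   | no _    = refl
  ... | no i∉A  | _       = contradiction i∈A i∉A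
  ... | yes _   | yes j∈A = contradiction j∈A j∉A

  crossing≡0 : ∀ {A} i j → ¬ (i ∈ A × j ∉ A) → crossing m A i j ≡ 0
  crossing≡0 {A} i j ¬leaving with i ∈? A | j ∈? A
  ... | yes i∈A | no j∉A = contradiction (i∈A , j∉A) ¬leaving
  ... | no _    | _      = refl
  ... | yes _   | yes _  = refl

  crossingEdges : Subset n → Mult n
  crossingEdges A i j = crossing m A i j + crossing m A j i

  crossingEdges-inside : ∀ {A i j} → (i ∈ A × j ∈ A) ⊎ (i ∉ A × j ∉ A) → crossingEdges A i j ≡ 0
  crossingEdges-inside {i = i} {j} (inj₁ (i∈A , j∈A)) =
    cong₂ _+_ (crossing≡0 i j λ (_ , j∉A) → j∉A j∈A) (crossing≡0 j i λ (_ , i∉A) → i∉A i∈A)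
  crossingEdges-inside {i = i} {j} (inj₂ (i∉A , j∉A)) =
    cong₂ _+_ (crossing≡0 i j λ (i∈A , _) → i∉A i∈A) (crossing≡0 j i λ (j∈A , _) → j∉A j∈A)

  crossingEdges≤ : Symmetric m → ∀ A i j → crossingEdges A i j ≤ m i j
  crossingEdges≤ m-sym A i j with i ∈? A | j ∈? A
  ... | yes _ | no _  = ℕ.≤-reflexive (ℕ.+-identityʳ (m i j))
  ... | no _  | yes _ = ℕ.≤-reflexive (m-sym j i)
  ... | yes _ | yes _ = z≤n
  ... | no _  | no _  = z≤n

  cutSize-∁ : Symmetric m → ∀ A → cutSize m (∁ A) ≡ cutSize m A
  cutSize-∁ m-sym A = trans (∑∑-cong transposed) (∑∑-transpose (crossing m A))
    where
    transposed : ∀ i j → crossing m (∁ A) i j ≡ crossing m A j i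
    transposed i j with i ∈? A | j ∈? A
    ... | yes i∈A | yes _ = crossing≡0 i j λ (i∈∁A , _) → x∈∁p⇒x∉p i∈∁A i∈A
    ... | yes i∈A | no _  = crossing≡0 i j λ (i∈∁A , _) → x∈∁p⇒x∉p i∈∁A i∈A
    ... | no _ | no j∉A = crossing≡0 i j λ (_ , j∉∁A) → j∉∁A (x∉p⇒x∈∁p j∉A)
    ... | no i∉A | yes j∈A =
      trans (crossing≡mult (x∉p⇒x∈∁p i∉A) (x∈p⇒x∉∁p j∈A)) (m-sym i j)

module _ {n : ℕ} where

  edgeCount-distrib-+ : (F H : Mult n) → edgeCount (λ i j → F i j + H i j) ≡ edgeCount F + edgeCount H
  edgeCount-distrib-+ F H = trans (∑∑-cong pointwise) (∑∑-distrib-+ (upper F) (upper H))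
    where
    pointwise : ∀ i j → upper (λ i j → F i j + H i j) i j ≡ upper F i j + upper H i j
    pointwise i j with toℕ i <? toℕ j
    ... | yes _ = refl
    ... | no _  = refl

  edgeCount-mono-≤ : {F H : Mult n} → (∀ i j → F i j ≤ H i j) → edgeCount F ≤ edgeCount H
  edgeCount-mono-≤ {F} {H} F≤H = ∑∑-mono-≤ pointwise
    where
    pointwise : ∀ i j → upper F i j ≤ upper H i j
    pointwise i j with toℕ i <? toℕ j
    ... | yes _ = F≤H i j
    ... | no _  = z≤n

  ∑∑≡edgeCount+edgeCountᵀ : (F : Mult n) → (∀ i → F i i ≡ 0) →
    ∑∑ F ≡ edgeCount F + edgeCount (flip F)
  ∑∑≡edgeCount+edgeCountᵀ F F-diag = begin
    ∑∑ F                                               ≡⟨ ∑∑-cong split ⟩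
    ∑∑ (λ i j → upper F i j + upper (flip F) j i)      ≡⟨ ∑∑-distrib-+ (upper F) _ ⟩
    edgeCount F + ∑∑ (λ i j → upper (flip F) j i)      ≡⟨ cong (edgeCount F +_) (∑∑-transpose (upper (flip F))) ⟩
    edgeCount F + edgeCount (flip F)                   ∎
    where
    open ≡-Reasoning
    split : ∀ i j → F i j ≡ upper F i j + upper (flip F) j i
    split i j with toℕ i <? toℕ j | toℕ j <? toℕ i
    ... | yes i<j | yes j<i = contradiction j<i (ℕ.<-asym i<j)
    ... | yes _   | no _    = sym (ℕ.+-identityʳ (F i j))
    ... | no _    | yes _   = refl
    ... | no i≮j  | no j≮i with toℕ-injective (ℕ.≤∧≮⇒≡ (ℕ.≮⇒≥ j≮i) i≮j)
    ...   | refl = F-diag i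

  edgeCount-symmetrise : (F : Mult n) → (∀ i → F i i ≡ 0) → edgeCount (λ i j → F i j + F j i) ≡ ∑∑ F
  edgeCount-symmetrise F F-diag =
    trans (edgeCount-distrib-+ F (flip F)) (sym (∑∑≡edgeCount+edgeCountᵀ F F-diag))

  edgeCount-crossingEdges : (m : Mult n) (A : Subset n) → edgeCount (crossingEdges {m = m} A) ≡ cutSize m A
  edgeCount-crossingEdges m A = edgeCount-symmetrise (crossing m A) λ i → crossing≡0 i i λ (i∈A , i∉A) → i∉A i∈A

  cutSize≤edgeCount : {t : Mult n} → Symmetric t → ∀ A → cutSize t A ≤ edgeCount t
  cutSize≤edgeCount {t} t-sym A = subst (_≤ edgeCount t) (edgeCount-crossingEdges t A)
    (edgeCount-mono-≤ (crossingEdges≤ t-sym A))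

  cutSize-mono-≤ : {m m′ : Mult n} (A : Subset n) → (∀ {i j} → i ∈ A → j ∉ A → m i j ≤ m′ i j) →
    cutSize m A ≤ cutSize m′ A
  cutSize-mono-≤ {m} {m′} A m≤m′ = ∑∑-mono-≤ pointwise
    where
    pointwise : ∀ i j → crossing m A i j ≤ crossing m′ A i j
    pointwise i j with i ∈? A | j ∈? A
    ... | yes i∈A | no j∉A = m≤m′ i∈A j∉A
    ... | yes _   | yes _  = z≤n
    ... | no _    | _      = z≤n

  cutSize-mono-< : {m : Mult n} (A A′ : Subset n) →
    (∀ {i j} → i ∈ A′ → j ∉ A′ → (i ∈ A × j ∉ A) ⊎ m i j ≡ 0) →
    ∀ {p q} → p ∈ A → q ∉ A → 0 < m p q → ¬ (p ∈ A′ × q ∉ A′) → cutSize m A′ < cutSize m A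
  cutSize-mono-< {m} A A′ leaves-A {p} {q} p∈A q∉A pq-edge pq-stays =
    ∑∑-mono-< pointwise p q (subst₂ _<_ (sym (crossing≡0 p q pq-stays)) (sym (crossing≡mult p∈A q∉A)) pq-edge)
    where
    pointwise : ∀ i j → crossing m A′ i j ≤ crossing m A i j
    pointwise i j with i ∈? A′ | j ∈? A′
    ... | no _     | _       = z≤n
    ... | yes _    | yes _   = z≤n
    ... | yes i∈A′ | no j∉A′ with leaves-A i∈A′ j∉A′
    ...   | inj₁ (i∈A , j∉A) = ℕ.≤-reflexive (sym (crossing≡mult i∈A j∉A))
    ...   | inj₂ mij≡0       = subst (_≤ crossing m A i j) (sym mij≡0) z≤n

module _ {n : ℕ} {m : Mult n} where

  walk-start : ∀ {S u v} → Walk m S u v → u ∈ S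
  walk-start (here u∈S)     = u∈S
  walk-start (step u∈S _ _) = u∈S

  walk-mono : ∀ {S S′ u v} → S ⊆ S′ → Walk m S u v → Walk m S′ u v
  walk-mono S⊆S′ (here u∈S)     = here (S⊆S′ u∈S)
  walk-mono S⊆S′ (step u∈S e w) = step (S⊆S′ u∈S) e (walk-mono S⊆S′ w)

  walk-map : ∀ {m′ : Mult n} {S u v} → (∀ {x y} → x ∈ S → y ∈ S → 0 < m x y → 0 < m′ x y) →
    Walk m S u v → Walk m′ S u v
  walk-map m⇒m′ (here u∈S)     = here u∈S
  walk-map m⇒m′ (step u∈S e w) = step u∈S (m⇒m′ u∈S (walk-start w) e) (walk-map m⇒m′ w)

  walk-++ : ∀ {S u v w} → Walk m S u v → Walk m S v w → Walk m S u w
  walk-++ (here _)       w₂ = w₂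
  walk-++ (step u∈S e w) w₂ = step u∈S e (walk-++ w w₂)

  data LeavingEdge (S D : Subset n) : Set where
    edge : ∀ {p q} → p ∈ D → q ∉ D → p ∈ S → q ∈ S → 0 < m p q → LeavingEdge S D

  leavingEdge? : ∀ S D → Dec (LeavingEdge S D)
  leavingEdge? S D = map′ from to (any? λ p → any? λ q →
    (p ∈? D) ×-dec ¬? (q ∈? D) ×-dec (p ∈? S) ×-dec (q ∈? S) ×-dec (0 <? m p q))
    where
    from : (∃ λ p → ∃ λ q → p ∈ D × q ∉ D × p ∈ S × q ∈ S × 0 < m p q) → LeavingEdge S D
    from (_ , _ , p∈D , q∉D , p∈S , q∈S , e) = edge p∈D q∉D p∈S q∈S e
    to : LeavingEdge S D → ∃ λ p → ∃ λ q → p ∈ D × q ∉ D × p ∈ S × q ∈ S × 0 < m p q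
    to (edge p∈D q∉D p∈S q∈S e) = _ , _ , p∈D , q∉D , p∈S , q∈S , e

  walk-leaving : ∀ {S D u v} → Walk m S u v → u ∈ D → v ∉ D → LeavingEdge S D
  walk-leaving (here _) u∈D u∉D = contradiction u∈D u∉D
  walk-leaving {D = D} (step {v = v} u∈S e w) u∈D w∉D with v ∈? D
  ... | yes v∈D = walk-leaving w v∈D w∉D
  ... | no  v∉D = edge u∈D v∉D u∈S (walk-start w) e

  walk-stays : ∀ {S D u v} → ¬ LeavingEdge S D → Walk m S u v → u ∈ D → v ∈ D
  walk-stays {D = D} {v = v} closed w u∈D with v ∈? D
  ... | yes v∈D = v∈D
  ... | no  v∉D = contradiction (walk-leaving w u∈D v∉D) closed

∣p∪⁅x⁆∣≡1+∣p∣ : ∀ {n} {p : Subset n} {x : Fin n} → x ∉ p → ∣ p ∪ ⁅ x ⁆ ∣ ≡ suc ∣ p ∣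
∣p∪⁅x⁆∣≡1+∣p∣ {p = outside ∷ p} {zero}  _   = cong suc (cong ∣_∣ (∪-identityʳ p))
∣p∪⁅x⁆∣≡1+∣p∣ {p = inside  ∷ p} {zero}  x∉p = contradiction here x∉p
∣p∪⁅x⁆∣≡1+∣p∣ {p = outside ∷ p} {suc x} x∉p = ∣p∪⁅x⁆∣≡1+∣p∣ (x∉p ∘ there)
∣p∪⁅x⁆∣≡1+∣p∣ {p = inside  ∷ p} {suc x} x∉p = cong suc (∣p∪⁅x⁆∣≡1+∣p∣ (x∉p ∘ there))

p∪⁅x⁆⊆q : ∀ {n} {p q : Subset n} {x} → p ⊆ q → x ∈ q → p ∪ ⁅ x ⁆ ⊆ q
p∪⁅x⁆⊆q {p = p} {x = x} p⊆q x∈q y∈p∪x with x∈p∪q⁻ p ⁅ x ⁆ y∈p∪x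
... | inj₁ y∈p = p⊆q y∈p
... | inj₂ y∈x rewrite x∈⁅y⁆⇒x≡y x y∈x = x∈q

module _ {n : ℕ} {m : Mult n} where

  connected-⁅⁆ : ∀ u → Connected m ⁅ u ⁆
  connected-⁅⁆ u = (u , x∈⁅x⁆ u) , λ x y x∈u y∈u → walk (x∈⁅y⁆⇒x≡y u x∈u) (x∈⁅y⁆⇒x≡y u y∈u)
    where
    walk : ∀ {x y} → x ≡ u → y ≡ u → Walk m ⁅ u ⁆ x y
    walk refl refl = here (x∈⁅x⁆ u)

  connected-∪⁅⁆ : Symmetric m → ∀ {C u v} → Connected m C → u ∈ C → 0 < m u v → Connected m (C ∪ ⁅ v ⁆)
  connected-∪⁅⁆ m-sym {C} {u} {v} ((c , c∈C) , walks) u∈C uv-edge =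
    (c , ⊆∪ c∈C) , λ x y x∈ y∈ → walk (x∈p∪q⁻ C ⁅ v ⁆ x∈) (x∈p∪q⁻ C ⁅ v ⁆ y∈)
    where
    ⊆∪ : C ⊆ C ∪ ⁅ v ⁆
    ⊆∪ = p⊆p∪q ⁅ v ⁆
    v∈ : v ∈ C ∪ ⁅ v ⁆
    v∈ = x∈p∪q⁺ (inj₂ (x∈⁅x⁆ v))
    to-v : ∀ {x} → x ∈ C → Walk m (C ∪ ⁅ v ⁆) x v
    to-v x∈C = walk-++ (walk-mono ⊆∪ (walks _ u x∈C u∈C)) (step (⊆∪ u∈C) uv-edge (here v∈))
    from-v : ∀ {y} → y ∈ C → Walk m (C ∪ ⁅ v ⁆) v y
    from-v y∈C = step v∈ (subst (0 <_) (m-sym u v) uv-edge) (walk-mono ⊆∪ (walks u _ u∈C y∈C))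
    walk : ∀ {x y} → x ∈ C ⊎ x ∈ ⁅ v ⁆ → y ∈ C ⊎ y ∈ ⁅ v ⁆ → Walk m (C ∪ ⁅ v ⁆) x y
    walk (inj₁ x∈C) (inj₁ y∈C) = walk-mono ⊆∪ (walks _ _ x∈C y∈C)
    walk (inj₁ x∈C) (inj₂ y∈v) rewrite x∈⁅y⁆⇒x≡y v y∈v = to-v x∈C
    walk (inj₂ x∈v) (inj₁ y∈C) rewrite x∈⁅y⁆⇒x≡y v x∈v = from-v y∈C
    walk (inj₂ x∈v) (inj₂ y∈v) rewrite x∈⁅y⁆⇒x≡y v x∈v | x∈⁅y⁆⇒x≡y v y∈v = here v∈

  connected-one-side : ∀ {A C} → ¬ LeavingEdge ⊤ A → ¬ LeavingEdge ⊤ (∁ A) → Connected m C →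
    C ⊆ A ⊎ C ⊆ ∁ A
  connected-one-side {A} {C} A-closed ∁A-closed ((c , c∈C) , walks) with c ∈? A
  ... | yes c∈A = inj₁ λ x∈C → walk-stays A-closed (walk-mono (λ _ → ∈⊤) (walks _ _ c∈C x∈C)) c∈A
  ... | no  c∉A = inj₂ λ x∈C →
    walk-stays ∁A-closed (walk-mono (λ _ → ∈⊤) (walks _ _ c∈C x∈C)) (x∉p⇒x∈∁p c∉A)

module Components {n : ℕ} {m : Mult n} (m-sym : Symmetric m) where

  closed⇒component : ∀ {S C} → C ⊆ S → Connected m C → ¬ LeavingEdge S C → IsComponent m S C
  closed⇒component {S} {C} C⊆S cC@((c , c∈C) , _) closed = C⊆S , cC , maximal
    where
    maximal : ∀ C′ → C ⊆ C′ → C′ ⊆ S → Connected m C′ → C′ ⊆ C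
    maximal C′ C⊆C′ C′⊆S (_ , walks) x∈C′ =
      walk-stays closed (walk-mono C′⊆S (walks _ _ (C⊆C′ c∈C) x∈C′)) c∈C

  component-closed : ∀ {S C} → IsComponent m S C → ¬ LeavingEdge S C
  component-closed {S} {C} (C⊆S , cC , maximal) (edge {q = q} p∈C q∉C _ q∈S pq-edge) =
    q∉C (maximal (C ∪ ⁅ q ⁆) (p⊆p∪q ⁅ q ⁆) (p∪⁅x⁆⊆q C⊆S q∈S) (connected-∪⁅⁆ m-sym cC p∈C pq-edge)
                 (x∈p∪q⁺ (inj₂ (x∈⁅x⁆ q))))

  component-containing : ∀ {S C} → C ⊆ S → Connected m C → ∃ λ D → IsComponent m S D × C ⊆ D
  component-containing {S} C⊆S cC = grow n C⊆S cC (ℕ.m≤n+m n _)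
    where
    grow : ∀ fuel {C} → C ⊆ S → Connected m C → n ≤ ∣ C ∣ + fuel → ∃ λ D → IsComponent m S D × C ⊆ D
    grow fuel {C} C⊆S cC bound with leavingEdge? S C
    ... | no closed = C , closed⇒component C⊆S cC closed , id
    ... | yes (edge {q = q} p∈C q∉C _ q∈S pq-edge) with fuel
    ...   | zero = contradiction (ℕ.≤-trans (∣p∣≤n (C ∪ ⁅ q ⁆)) (subst (n ≤_) (ℕ.+-identityʳ _) bound))
                     (ℕ.<⇒≱ (ℕ.≤-reflexive (sym (∣p∪⁅x⁆∣≡1+∣p∣ q∉C))))
    ...   | suc fuel with grow fuel (p∪⁅x⁆⊆q C⊆S q∈S) (connected-∪⁅⁆ m-sym cC p∈C pq-edge)
                         (subst (n ≤_) (trans (ℕ.+-suc _ fuel) (cong (_+ fuel) (sym (∣p∪⁅x⁆∣≡1+∣p∣ q∉C)))) bound)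
    ...     | D , D-component , C∪q⊆D = D , D-component , C∪q⊆D ∘ p⊆p∪q ⁅ q ⁆

  connected-subset-of-size : ∀ {C} k → Connected m C → suc k ≤ ∣ C ∣ →
    ∃ λ E → E ⊆ C × Connected m E × ∣ E ∣ ≡ suc k
  connected-subset-of-size {C} zero ((c , c∈C) , _) _ =
    ⁅ c ⁆ , (λ x∈c → subst (_∈ C) (sym (x∈⁅y⁆⇒x≡y c x∈c)) c∈C) , connected-⁅⁆ c , ∣⁅x⁆∣≡1 c
  connected-subset-of-size {C} (suc k) cC k<∣C∣
    with connected-subset-of-size k cC (ℕ.<⇒≤ k<∣C∣)
  ... | E , E⊆C , cE@((e , e∈E) , _) , ∣E∣≡1+k with leavingEdge? C E
  ...   | yes (edge {q = q} p∈E q∉E _ q∈C pq-edge) =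
    E ∪ ⁅ q ⁆ , p∪⁅x⁆⊆q E⊆C q∈C , connected-∪⁅⁆ m-sym cE p∈E pq-edge ,
    trans (∣p∪⁅x⁆∣≡1+∣p∣ q∉E) (cong suc ∣E∣≡1+k)
  ...   | no closed = contradiction (p⊆q⇒∣p∣≤∣q∣ C⊆E) (ℕ.<⇒≱ (subst (_< ∣ C ∣) (sym ∣E∣≡1+k) k<∣C∣))
    where
    C⊆E : C ⊆ E
    C⊆E x∈C = walk-stays closed (proj₂ cC _ _ (E⊆C e∈E) x∈C) e∈E

  component-⊤-missing : ∀ {A} → IsComponent m ⊤ A → ¬ Connected m ⊤ → ∃ λ w → w ∉ A
  component-⊤-missing {A} (_ , ((a , _) , walks) , _) disconnected with any? (λ w → ¬? (w ∈? A))
  ... | yes found = found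
  ... | no  none  = contradiction ((a , ∈⊤) , λ x y _ _ → walk-mono (λ _ → ∈⊤) (walks x y (everything x) (everything y)))
                                  disconnected
    where
    everything : ∀ x → x ∈ A
    everything x = decidable-stable (x ∈? A) λ x∉A → none (x , x∉A)

IsMin-unique : ∀ {P : ℕ → Set} {x y} → IsMin P x → IsMin P y → x ≡ y
IsMin-unique {x = fin x} {fin y} (Px , x≤) (Py , y≤) = cong fin (ℕ.≤-antisym (x≤ y Py) (y≤ x Px))
IsMin-unique {x = fin x} {∞}     (Px , _) none = contradiction Px (none x)
IsMin-unique {x = ∞}     {fin y} none (Py , _) = contradiction Py (none y)
IsMin-unique {x = ∞}     {∞}     _ _           = refl

IsMin-≡ : ∀ {P Q : ℕ → Set} {x y} →
  (∀ {s} → P s → ∃ λ z → Q z × z ≤ s) → (∀ {z} → Q z → (∀ z′ → Q z′ → z ≤ z′) → P z) →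
  IsMin P x → IsMin Q y → y ≡ x
IsMin-≡ {x = fin x} {fin y} P⇒Q Qmin⇒P (Px , x≤) (Qy , y≤) with P⇒Q Px
... | z , Qz , z≤x = cong fin (ℕ.≤-antisym (ℕ.≤-trans (y≤ z Qz) z≤x) (x≤ y (Qmin⇒P Qy y≤)))
IsMin-≡ {x = fin x} {∞}     P⇒Q _ (Px , _) none with P⇒Q Px
... | z , Qz , _ = contradiction Qz (none z)
IsMin-≡ {x = ∞}     {fin y} _ Qmin⇒P none (Qy , y≤) = contradiction (Qmin⇒P Qy y≤) (none y)
IsMin-≡ {x = ∞}     {∞}     _ _ _ _ = refl

min∞-comm : ∀ x y → min∞ x y ≡ min∞ y x
min∞-comm (fin x) (fin y) = cong fin (ℕ.⊓-comm x y)
min∞-comm (fin x) ∞       = refl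
min∞-comm ∞       (fin y) = refl
min∞-comm ∞       ∞       = refl

module _ {n : ℕ} (G : Graph n) where

  private
    m = mult G
    m-sym : Symmetric m
    m-sym = symmetric G

  open Components m-sym

  Hits : ℕ → Subset n → Set
  Hits k X = ∀ E → Egg (𝓔 G k) E → ∃ λ v → v ∈ E × v ∈ X

  ComponentsAtMost : ℕ → Subset n → Set
  ComponentsAtMost j S = ∀ C → IsComponent m S C → ∣ C ∣ ≤ j

  ∁-hits : ∀ {j S} → ComponentsAtMost j S → Hits (suc j) (∁ S)
  ∁-hits {j} {S} small E (cE , ∣E∣≡1+j) with any? (λ v → (v ∈? E) ×-dec (v ∈? ∁ S))
  ... | yes hit  = hit
  ... | no  miss with component-containing E⊆S cE
    where
    E⊆S : E ⊆ S
    E⊆S {x} x∈E = x∉∁p⇒x∈p λ x∈∁S → miss (x , x∈E , x∈∁S)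
  ...   | D , D-comp , E⊆D =
    contradiction (subst (_≤ ∣ D ∣) ∣E∣≡1+j (p⊆q⇒∣p∣≤∣q∣ E⊆D)) (ℕ.<⇒≱ (s≤s (small D D-comp)))

  hits⇒∁-small : ∀ {j X} → Hits (suc j) X → ComponentsAtMost j (∁ X)
  hits⇒∁-small {j} hits C (C⊆∁X , cC , _) with ∣ C ∣ ≤? j
  ... | yes small = small
  ... | no  large with connected-subset-of-size j cC (ℕ.≰⇒> large)
  ...   | E , E⊆C , cE , ∣E∣≡1+j with hits E (cE , ∣E∣≡1+j)
  ...     | v , v∈E , v∈X = contradiction v∈X (x∈∁p⇒x∉p (C⊆∁X (E⊆C v∈E)))

  hittingNumber : ∀ {j a} → IsAlphaC G j a → IsHitting (𝓔 G (suc j)) (fin (n ∸ a))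
  hittingNumber {j} {a} ((S , ∣S∣≡a , S-small) , maximal) =
    (∁ S , trans (∣∁p∣≡n∸∣p∣ S) (cong (n ∸_) ∣S∣≡a) , ∁-hits S-small) , lower
    where
    lower : ∀ y → (Σ (Subset n) λ X → ∣ X ∣ ≡ y × Hits (suc j) X) → n ∸ a ≤ y
    lower _ (X , refl , X-hits) = begin
      n ∸ a               ≤⟨ ℕ.∸-monoʳ-≤ n (maximal ∣ ∁ X ∣ (∁ X , refl , hits⇒∁-small X-hits)) ⟩
      n ∸ ∣ ∁ X ∣         ≡⟨ cong (n ∸_) (∣∁p∣≡n∸∣p∣ X) ⟩
      n ∸ (n ∸ ∣ X ∣)     ≡⟨ ℕ.m∸[m∸n]≡n (∣p∣≤n X) ⟩
      ∣ X ∣               ∎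
      where open ℕ.≤-Reasoning

  KCut : ℕ → ℕ → Set
  KCut k s = Σ (Mult n) λ t →
      IsEdgeSubMultiset G t × edgeCount t ≡ s
    × ¬ Connected (remove G t) ⊤
    × (∀ C → IsComponent (remove G t) ⊤ C → k ≤ ∣ C ∣)

  EggCutOfSize : ℕ → ℕ → Set
  EggCutOfSize k s = Σ (Subset n) λ A → IsEggCut (𝓔 G k) A × cutSize m A ≡ s

  -- If C were small, moving C to the other side of A would give a smaller egg-cut.
  minimumEggCut-component-large : ∀ {k A C} {r : Mult n} → IsEggCut (𝓔 G k) A →
    (∀ A′ → IsEggCut (𝓔 G k) A′ → cutSize m A ≤ cutSize m A′) →
    Symmetric r → (∀ {i j} → i ∈ A → j ∈ A → r i j ≡ m i j) →
    IsComponent r ⊤ C → C ⊆ A → k ≤ ∣ C ∣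
  minimumEggCut-component-large {k} {A} {C} {r}
    ((E₁ , (cE₁ , ∣E₁∣≡k) , E₁⊆A) , (E₂ , E₂-egg@(((b , b∈E₂) , _) , _) , E₂⊆∁A))
    minimal r-sym r≡m C-comp@(_ , ((c , c∈C) , _) , _) C⊆A with k ≤? ∣ C ∣
  ... | yes large = large
  ... | no  small with walk-leaving (proj₂ (connected G) c b ∈⊤ ∈⊤) c∈C b∉C
    where
    b∉C : b ∉ C
    b∉C b∈C = x∈∁p⇒x∉p (E₂⊆∁A b∈E₂) (C⊆A b∈C)
  ...   | edge {p} {q} p∈C q∉C _ _ pq-edge = contradiction (minimal A′ A′-eggCut) (ℕ.<⇒≱ A′-smaller)
    where
    C-closed : ¬ LeavingEdge {m = r} ⊤ C
    C-closed = Components.component-closed r-sym C-comp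
    A′ = A ∩ ∁ C
    q∉A : q ∉ A
    q∉A q∈A = C-closed (edge p∈C q∉C ∈⊤ ∈⊤ (subst (0 <_) (sym (r≡m (C⊆A p∈C) q∈A)) pq-edge))
    E₁-avoids-C : ∀ {z} → z ∈ E₁ → z ∉ C
    E₁-avoids-C {z} z∈E₁ z∈C = small (subst (_≤ ∣ C ∣) ∣E₁∣≡k (p⊆q⇒∣p∣≤∣q∣ E₁⊆C))
      where
      E₁⊆C : E₁ ⊆ C
      E₁⊆C x∈E₁ = walk-stays C-closed
        (walk-mono (λ _ → ∈⊤) (walk-map (λ x∈ y∈ → subst (0 <_) (sym (r≡m (E₁⊆A x∈) (E₁⊆A y∈))))
                                        (proj₂ cE₁ _ _ z∈E₁ x∈E₁)))
        z∈C
    A′-eggCut : IsEggCut (𝓔 G k) A′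
    A′-eggCut =
        (E₁ , (cE₁ , ∣E₁∣≡k) , λ x∈E₁ → x∈p∩q⁺ (E₁⊆A x∈E₁ , x∉p⇒x∈∁p (E₁-avoids-C x∈E₁)))
      , (E₂ , E₂-egg , λ x∈E₂ → x∉p⇒x∈∁p λ x∈A′ →
           x∈∁p⇒x∉p (E₂⊆∁A x∈E₂) (proj₁ (x∈p∩q⁻ A (∁ C) x∈A′)))
    leaves-A : ∀ {i j} → i ∈ A′ → j ∉ A′ → (i ∈ A × j ∉ A) ⊎ m i j ≡ 0
    leaves-A {i} {j} i∈A′ j∉A′ with x∈p∩q⁻ A (∁ C) i∈A′ | j ∈? A | j ∈? C
    ... | i∈A , _    | no j∉A | _      = inj₁ (i∈A , j∉A)
    ... | _          | yes j∈A | no j∉C = contradiction (x∈p∩q⁺ (j∈A , x∉p⇒x∈∁p j∉C)) j∉A′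
    ... | i∈A , i∈∁C | yes j∈A | yes j∈C = inj₂ (ℕ.n≤0⇒n≡0 (ℕ.≮⇒≥ λ ij-edge →
      C-closed (edge j∈C (x∈∁p⇒x∉p i∈∁C) ∈⊤ ∈⊤
        (subst (0 <_) (sym (trans (r≡m j∈A i∈A) (m-sym j i))) ij-edge))))
    A′-smaller : cutSize m A′ < cutSize m A
    A′-smaller = cutSize-mono-< A A′ leaves-A (C⊆A p∈C) q∉A pq-edge
      λ (p∈A′ , _) → x∈∁p⇒x∉p (proj₂ (x∈p∩q⁻ A (∁ C) p∈A′)) p∈C

  kCut⇒eggCut : ∀ j {s} → KCut (suc j) s → ∃ λ y → EggCutOfSize (suc j) y × y ≤ s
  kCut⇒eggCut j {s} (t , (t-sym , t≤m) , ∣t∣≡s , disconnected , large) =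
    cutSize m A , (A , (egg-inside A-comp , egg-outside) , refl) , cut≤s
    where
    rm = remove G t
    open Components {m = rm} (λ i j → cong₂ _∸_ (m-sym i j) (t-sym i j)) using ()
      renaming (component-containing to rm-component-containing; component-closed to rm-component-closed;
                component-⊤-missing to rm-component-⊤-missing)
    egg-inside : ∀ {C} → IsComponent rm ⊤ C → Σ (Subset n) λ E → Egg (𝓔 G (suc j)) E × E ⊆ C
    egg-inside C-comp@(_ , (C-ne , walks) , _)
      with connected-subset-of-size j (C-ne , λ x y x∈C y∈C → walk-map (λ _ _ → rm⇒m) (walks x y x∈C y∈C))
                                      (large _ C-comp)
      where
      rm⇒m : ∀ {x y} → 0 < rm x y → 0 < m x y
      rm⇒m {x} {y} e = ℕ.≤-trans e (ℕ.m∸n≤m (m x y) (t x y))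
    ... | E , E⊆C , cE , ∣E∣≡1+j = E , (cE , ∣E∣≡1+j) , E⊆C
    u = proj₁ (proj₁ (connected G))
    A = proj₁ (rm-component-containing (λ _ → ∈⊤) (connected-⁅⁆ u))
    A-comp = proj₁ (proj₂ (rm-component-containing (λ _ → ∈⊤) (connected-⁅⁆ u)))
    egg-outside : Σ (Subset n) λ E → Egg (𝓔 G (suc j)) E × E ⊆ ∁ A
    egg-outside with rm-component-⊤-missing A-comp disconnected
    ... | w , w∉A with rm-component-containing (λ _ → ∈⊤) (connected-⁅⁆ w)
    ...   | B , B-comp@(_ , (_ , walks) , _) , w⊆B with egg-inside B-comp
    ...     | E , E-egg , E⊆B = E , E-egg , λ x∈E → x∉p⇒x∈∁p λ x∈A →
      w∉A (walk-stays (rm-component-closed A-comp) (walk-mono (λ _ → ∈⊤) (walks _ w (E⊆B x∈E) (w⊆B (x∈⁅x⁆ w)))) x∈A)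
    m≤t : ∀ {i j} → i ∈ A → j ∉ A → m i j ≤ t i j
    m≤t i∈A j∉A = ℕ.m∸n≡0⇒m≤n (ℕ.n≤0⇒n≡0 (ℕ.≮⇒≥ λ e → rm-component-closed A-comp (edge i∈A j∉A ∈⊤ ∈⊤ e)))
    cut≤s : cutSize m A ≤ s
    cut≤s = ℕ.≤-trans (cutSize-mono-≤ A m≤t) (subst (cutSize t A ≤_) ∣t∣≡s (cutSize≤edgeCount t-sym A))

  minimumEggCut⇒kCut : ∀ {k y} → EggCutOfSize k y → (∀ z → EggCutOfSize k z → y ≤ z) → KCut k y
  minimumEggCut⇒kCut {k} {y} (A , A-eggCut@((E₁ , E₁-egg , E₁⊆A) , (E₂ , E₂-egg , E₂⊆∁A)) , ∣A∣≡y) minimal =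
    t , (t-sym , crossingEdges≤ m-sym A) , trans (edgeCount-crossingEdges m A) ∣A∣≡y , disconnected , large
    where
    t = crossingEdges {m = m} A
    t-sym : Symmetric t
    t-sym i j = ℕ.+-comm (crossing m A i j) (crossing m A j i)
    rm = remove G t
    rm-sym : Symmetric rm
    rm-sym i j = cong₂ _∸_ (m-sym i j) (t-sym i j)
    rm≡m : ∀ {i j} → (i ∈ A × j ∈ A) ⊎ (i ∉ A × j ∉ A) → rm i j ≡ m i j
    rm≡m {i} {j} same-side = cong (m i j ∸_) (crossingEdges-inside {m = m} same-side)
    no-rm-edge : ∀ {p q} → m p q ≤ t p q → ¬ 0 < rm p q
    no-rm-edge m≤t e = ℕ.n≮0 (subst (0 <_) (ℕ.m≤n⇒m∸n≡0 m≤t) e)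
    A-closed : ¬ LeavingEdge {m = rm} ⊤ A
    A-closed (edge {p} {q} p∈A q∉A _ _ e) = no-rm-edge
      (ℕ.≤-trans (ℕ.≤-reflexive (sym (crossing≡mult {m = m} p∈A q∉A))) (ℕ.m≤m+n _ (crossing m A q p))) e
    ∁A-closed : ¬ LeavingEdge {m = rm} ⊤ (∁ A)
    ∁A-closed (edge {p} {q} p∈∁A q∉∁A _ _ e) = no-rm-edge
      (ℕ.≤-trans (ℕ.≤-reflexive (trans (m-sym p q) (sym (crossing≡mult {m = m} (x∉∁p⇒x∈p q∉∁A) (x∈∁p⇒x∉p p∈∁A)))))
                 (ℕ.m≤n+m _ (crossing m A p q))) e
    disconnected : ¬ Connected rm ⊤
    disconnected c with connected-one-side A-closed ∁A-closed c
    ... | inj₁ ⊤⊆A  = x∈∁p⇒x∉p (E₂⊆∁A (proj₂ (proj₁ (proj₁ E₂-egg)))) (⊤⊆A ∈⊤)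
    ... | inj₂ ⊤⊆∁A = x∈∁p⇒x∉p (⊤⊆∁A ∈⊤) (E₁⊆A (proj₂ (proj₁ (proj₁ E₁-egg))))
    A-minimal : ∀ A′ → IsEggCut (𝓔 G k) A′ → cutSize m A ≤ cutSize m A′
    A-minimal A′ A′-eggCut = subst (_≤ _) (sym ∣A∣≡y) (minimal _ (A′ , A′-eggCut , refl))
    ∁A-eggCut : IsEggCut (𝓔 G k) (∁ A)
    ∁A-eggCut = (E₂ , E₂-egg , E₂⊆∁A) , (E₁ , E₁-egg , x∉p⇒x∈∁p ∘ x∈p⇒x∉∁p ∘ E₁⊆A)
    large : ∀ C → IsComponent rm ⊤ C → k ≤ ∣ C ∣
    large C C-comp@(_ , cC , _) with connected-one-side A-closed ∁A-closed cC
    ... | inj₁ C⊆A = minimumEggCut-component-large A-eggCut A-minimal rm-sym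
      (λ i∈A j∈A → rm≡m (inj₁ (i∈A , j∈A))) C-comp C⊆A
    ... | inj₂ C⊆∁A = minimumEggCut-component-large ∁A-eggCut
      (λ A′ A′-eggCut → subst (_≤ _) (sym (cutSize-∁ m-sym A)) (A-minimal A′ A′-eggCut)) rm-sym
      (λ i∈∁A j∈∁A → rm≡m (inj₂ (x∈∁p⇒x∉p i∈∁A , x∈∁p⇒x∉p j∈∁A))) C-comp C⊆∁A

  eggCutNumber≡λ : ∀ j {l e} → IsLambda G (suc j) l → IsEggCutNumber (𝓔 G (suc j)) e → e ≡ l
  eggCutNumber≡λ j = IsMin-≡ (kCut⇒eggCut j) minimumEggCut⇒kCut

theorem3p3 : ∀ {n} (G : Graph n) (k : ℕ) → 1 ≤ k →
    ∀ (l : ℕ∞) (a : ℕ) → IsLambda G k l → IsAlphaC G (k ∸ 1) a →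
    IsOrder (𝓔 G k) (min∞ l (fin (n ∸ a)))
theorem3p3 {n} G (suc j) _ l a isλ isα h e isH isE = begin
  min∞ l (fin (n ∸ a))  ≡⟨ min∞-comm l (fin (n ∸ a)) ⟩
  min∞ (fin (n ∸ a)) l  ≡⟨ cong₂ min∞ (IsMin-unique (hittingNumber G isα) isH) (sym (eggCutNumber≡λ G j isλ isE)) ⟩
  min∞ h e              ∎
  where open ≡-Reasoning
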